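{- Let $V$ be a set, $f:V\to V$ a function, and $D$ the digraph on $V$ with an arc $f(v)\to v$ for every $v\in V$ (the opposite of the functional digraph of $f$). Let $C\subseteq V$ be the largest subset such that the induced digraph $D|_C$ is (the digraph of) a permutation, assume every $v\in V$ satisfies $f^k(v)\in C$ for some $k\ge 0$, and assume the formal power series below are well defined (finitely many terms for each exponent). Let $h(x)=\sum_{v\in V}x^{\mathrm{level}(v)}$ where $\mathrm{level}(v)=\min\{k\geq 0: f^k(v)\in C\}$, and let $g(x)=\sum_{p}x^{\ell(p)}$, the sum over all directed paths $p=(v_0\to v_1\to\cdots\to v_i)$ in $D$ with $v_0\in C$ (including paths of length $0$), where $\ell(p)=i$. Then \[ h(x)=(1-x)\,g(x). \]
   Context: The directed paths in $D$ starting in $C$ are the vertices of the so-called quasi-infinite forest of $D$; paths may traverse cycles within $C$ any number of times. -}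

module Defs where

open import Level using ()
open import Data.Nat using (ℕ; zero; suc; _<_)
open import Data.Integer using (ℤ; +_; _-_)
open import Data.Fin using (Fin; inject₁)
open import Data.Vec using (Vec; lookup; head)
open import Data.List using (List; length)
open import Data.List.Membership.Propositional using (_∈_)
open import Data.List.Relation.Unary.Unique.Propositional using (Unique)
open import Data.Product using (Σ; ∃; _×_)
open import Relation.Binary.PropositionalEquality using (_≡_)
open import Relation.Nullary using (¬_)
open import Function.Bundles using (_⇔_)

iter : {V : Set} → (V → V) → ℕ → V → V
iter f zero    v = v
iter f (suc k) v = f (iter f k v)

-- The induced digraph D|_S has the
-- arcs f(v) → v with v ∈ S and f(v) ∈ S.  It is (the digraph of) a permutation
-- iff every vertex of S has in-degree exactly 1 and out-degree exactly 1 in D|_S: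
--   in-degree of v ∈ S is 1  iff  f v ∈ S  (the only possible arc into v is f v → v);
--   out-degree of u ∈ S is 1 iff there is exactly one v ∈ S with f v ≡ u.
IsPermDigraph : {V : Set} → (V → V) → (V → Set) → Set
IsPermDigraph {V} f S =
  ((v : V) → S v → S (f v)) ×
  ((u : V) → S u → Σ V λ v → S v × f v ≡ u × ((w : V) → S w → f w ≡ u → w ≡ v))

IsLargestPermSubset : {V : Set} → (V → V) → (V → Set) → Set₁
IsLargestPermSubset {V} f C =
  IsPermDigraph f C × ((S : V → Set) → IsPermDigraph f S → (v : V) → S v → C v)

HasLevel : {V : Set} → (V → V) → (V → Set) → V → ℕ → Set
HasLevel f C v n = C (iter f n v) × ((j : ℕ) → j < n → ¬ C (iter f j v))

-- directed paths v₀ → v₁ → ⋯ → vₙ in D (arc vⱼ → vⱼ₊₁ means f vⱼ₊₁ ≡ vⱼ)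
-- of length n starting in C, as vertex sequences
IsPathFromC : {V : Set} → (V → V) → (V → Set) → (n : ℕ) → Vec V (suc n) → Set
IsPathFromC f C n p =
  C (head p) × ((j : Fin n) → f (lookup p (Fin.suc j)) ≡ lookup p (inject₁ j))

HasCount : {A : Set} → (A → Set) → ℕ → Set
HasCount {A} P m =
  Σ (List A) λ xs → Unique xs × ((a : A) → (a ∈ xs) ⇔ P a) × length xs ≡ m

-- formal power series with integer coefficients: ℕ → ℤ (coefficient sequence);
-- coefficients of (1 - x) · a
oneMinusX* : (ℕ → ℤ) → ℕ → ℤ
oneMinusX* a zero    = a zero
oneMinusX* a (suc n) = a (suc n) - a n

{-# OPTIONS --safe #-}
module Submission where

-- A path of length n starting in C is determined by its last vertex v: it is
-- (fⁿ v, …, f v, v), and this is a path from C iff fⁿ v ∈ C. As C is closed under f,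
-- the paths of length n + 1 split into those whose last vertex has level exactly
-- n + 1 and the extensions f(v₀) → v₀ → ⋯ of paths of length n, so
-- g(n+1) = h(n+1) + g(n), the coefficientwise form of h = (1 - x) g. Membership in C is not
-- decidable, so the splitting only holds up to double negation, which is enough
-- to compare two natural numbers.

open import Defs
open import Data.Nat using (ℕ; suc)
open import Data.Integer using (+_)
open import Data.Vec using (Vec)
open import Data.Product using (∃)
open import Relation.Binary.PropositionalEquality using (_≡_)

open import Data.Nat using (zero; _+_; _≤_; _≤′_; _≤?_; s≤s; z≤n; ≤′-reflexive; ≤′-step)
open import Data.Nat.Properties using (≤-antisym; ≤⇒≤′; n<1+n; m≤n+m; m+n∸n≡m)
open import Data.Integer using (_-_)
open import Data.Integer.Properties using ([+m]-[+n]≡m⊖n; ≤-⊖)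
open import Data.Fin using (Fin; fromℕ; inject₁)
open import Data.Vec using (_∷_; []; head; tail; lookup)
open import Data.List using (List; length; map; _++_)
open import Data.List.Properties using (length-map; length-++; length-removeAt′)
open import Data.List.Relation.Unary.Any using (here; there; index)
import Data.List.Relation.Unary.All as All
open import Data.List.Relation.Unary.AllPairs using ([]; _∷_)
open import Data.List.Membership.Propositional using (_∈_; _─_)
open import Data.List.Membership.Propositional.Properties using (∈-map⁺; ∈-map⁻; ∈-++⁺ˡ; ∈-++⁺ʳ; ∈-++⁻)
open import Data.List.Relation.Binary.Subset.Propositional using (_⊆_)
open import Data.List.Relation.Unary.Unique.Propositional using (Unique)
import Data.List.Relation.Unary.Unique.Propositional.Properties as Unique
open import Data.Product using (_×_; _,_)
open import Data.Sum using (_⊎_; inj₁; inj₂) renaming (map to map-⊎)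
open import Data.Empty using (⊥-elim)
open import Function using (_∘_)
open import Function.Bundles using (_⇔_; mk⇔; Equivalence)
open import Function.Definitions using (Injective)
open import Relation.Nullary using (¬_; Dec; yes; no)
open import Relation.Nullary.Decidable using (decidable-stable; ¬¬-excluded-middle)
open import Relation.Nullary.Negation using (¬¬-map)
open import Relation.Binary.PropositionalEquality using (_≢_; refl; sym; trans; cong; cong₂; subst; module ≡-Reasoning)
open ≡-Reasoning

module _ {A : Set} where

  ∈-─ : ∀ {x y} {ys : List A} (x∈ys : x ∈ ys) → y ∈ ys → y ≢ x → y ∈ ys ─ x∈ys
  ∈-─ (here refl)  (here refl)  y≢x = ⊥-elim (y≢x refl)
  ∈-─ (here refl)  (there y∈ys)  _   = y∈ys
  ∈-─ (there _)    (here y≡z)    _   = here y≡z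
  ∈-─ (there x∈ys) (there y∈ys) y≢x = there (∈-─ x∈ys y∈ys y≢x)

  length-≤-of-⊆ : {xs ys : List A} → Unique xs → xs ⊆ ys → length xs ≤ length ys
  length-≤-of-⊆ [] _ = z≤n
  length-≤-of-⊆ {ys = ys} (x≢xs ∷ unique) xs⊆ys =
    subst (_ ≤_) (sym (length-removeAt′ ys (index x∈ys)))
      (s≤s (length-≤-of-⊆ unique λ y∈xs →
        ∈-─ x∈ys (xs⊆ys (there y∈xs)) (λ y≡x → All.lookup x≢xs y∈xs (sym y≡x))))
    where x∈ys = xs⊆ys (here refl)

  ¬¬-⊆ : {xs ys : List A} → (∀ {x} → x ∈ xs → ¬ ¬ x ∈ ys) → ¬ ¬ xs ⊆ ys
  ¬¬-⊆ {List.[]} _ ¬⊆ = ¬⊆ λ ()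
  ¬¬-⊆ {x List.∷ xs} ¬¬⊆ ¬⊆ =
    ¬¬⊆ (here refl) λ x∈ys → ¬¬-⊆ (¬¬⊆ ∘ there) λ xs⊆ys →
      ¬⊆ λ { (here refl) → x∈ys ; (there y∈xs) → xs⊆ys y∈xs }

Image : {A B : Set} → (A → B) → (A → Set) → B → Set
Image g P y = ∃ λ x → P x × g x ≡ y

module _ {A : Set} {P Q : A → Set} where

  HasCount-≡ : {a b : ℕ} → HasCount P a → HasCount Q b →
               (∀ x → P x → Q x) → (∀ x → Q x → ¬ ¬ P x) → a ≡ b
  HasCount-≡ (xs , uxs , ∈xs⇔ , refl) (ys , uys , ∈ys⇔ , refl) P⊆Q Q⊆¬¬P =
    ≤-antisym (length-≤-of-⊆ uxs xs⊆ys)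
      (decidable-stable (length ys ≤? length xs) (¬¬-map (length-≤-of-⊆ uys) ¬¬ys⊆xs))
    where
    xs⊆ys : xs ⊆ ys
    xs⊆ys x∈xs = Equivalence.from (∈ys⇔ _) (P⊆Q _ (Equivalence.to (∈xs⇔ _) x∈xs))
    ¬¬ys⊆xs : ¬ ¬ ys ⊆ xs
    ¬¬ys⊆xs = ¬¬-⊆ λ y∈ys → ¬¬-map (Equivalence.from (∈xs⇔ _)) (Q⊆¬¬P _ (Equivalence.to (∈ys⇔ _) y∈ys))

  HasCount-⊎ : {a b : ℕ} → HasCount P a → HasCount Q b →
               (∀ x → P x → ¬ Q x) → HasCount (λ x → P x ⊎ Q x) (a + b)
  HasCount-⊎ (xs , uxs , ∈xs⇔ , refl) (ys , uys , ∈ys⇔ , refl) P∩Q=∅ =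
    xs ++ ys , Unique.++⁺ uxs uys disjoint , ∈xs++ys⇔ , length-++ xs
    where
    disjoint : ∀ {x} → ¬ (x ∈ xs × x ∈ ys)
    disjoint (x∈xs , x∈ys) = P∩Q=∅ _ (Equivalence.to (∈xs⇔ _) x∈xs) (Equivalence.to (∈ys⇔ _) x∈ys)
    ∈xs++ys⇔ : ∀ x → (x ∈ xs ++ ys) ⇔ (P x ⊎ Q x)
    ∈xs++ys⇔ x = mk⇔
      (λ x∈ → map-⊎ (Equivalence.to (∈xs⇔ x)) (Equivalence.to (∈ys⇔ x)) (∈-++⁻ xs x∈))
      λ { (inj₁ px) → ∈-++⁺ˡ (Equivalence.from (∈xs⇔ x) px)
        ; (inj₂ qx) → ∈-++⁺ʳ xs (Equivalence.from (∈ys⇔ x) qx) }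

HasCount-Image : {A B : Set} {P : A → Set} {a : ℕ} (g : A → B) → Injective _≡_ _≡_ g →
                 HasCount P a → HasCount (Image g P) a
HasCount-Image {P = P} g g-inj (xs , uxs , ∈xs⇔ , refl) =
  map g xs , Unique.map⁺ g-inj uxs , ∈map⇔ , length-map g xs
  where
  ∈map⇔ : ∀ y → (y ∈ map g xs) ⇔ Image g P y
  ∈map⇔ y = mk⇔
    (λ y∈ → let x , x∈xs , y≡gx = ∈-map⁻ g y∈ in x , Equivalence.to (∈xs⇔ x) x∈xs , sym y≡gx)
    λ { (x , px , refl) → ∈-map⁺ g (Equivalence.from (∈xs⇔ x) px) }

module Paths {V : Set} (f : V → V) where

  Arcs : (n : ℕ) → Vec V (suc n) → Set
  Arcs n p = (j : Fin n) → f (lookup p (Fin.suc j)) ≡ lookup p (inject₁ j)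

  extend : {n : ℕ} → Vec V (suc n) → Vec V (suc (suc n))
  extend p = f (head p) ∷ p

  extend-injective : {n : ℕ} → Injective _≡_ _≡_ (extend {n})
  extend-injective = cong tail

  extend-arcs : {n : ℕ} (p : Vec V (suc n)) → Arcs n p → Arcs (suc n) (extend p)
  extend-arcs (_ ∷ _) _    Fin.zero    = refl
  extend-arcs _       arcs (Fin.suc j) = arcs j

  pathTo : (n : ℕ) → V → Vec V (suc n)
  pathTo zero    v = v ∷ []
  pathTo (suc n) v = extend (pathTo n v)

  head-pathTo : ∀ n v → head (pathTo n v) ≡ iter f n v
  head-pathTo zero    v = refl
  head-pathTo (suc n) v = cong f (head-pathTo n v)

  last-pathTo : ∀ n v → lookup (pathTo n v) (fromℕ n) ≡ v
  last-pathTo zero    v = refl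
  last-pathTo (suc n) v = last-pathTo n v

  pathTo-injective : ∀ n → Injective _≡_ _≡_ (pathTo n)
  pathTo-injective n {v} {w} eq =
    trans (sym (last-pathTo n v)) (trans (cong (λ p → lookup p (fromℕ n)) eq) (last-pathTo n w))

  pathTo-arcs : ∀ n v → Arcs n (pathTo n v)
  pathTo-arcs zero    v ()
  pathTo-arcs (suc n) v = extend-arcs (pathTo n v) (pathTo-arcs n v)

  arcs⇒≡pathTo : ∀ n (p : Vec V (suc n)) → Arcs n p → p ≡ pathTo n (lookup p (fromℕ n))
  arcs⇒≡pathTo zero    (_ ∷ [])     _    = refl
  arcs⇒≡pathTo (suc n) (x ∷ y ∷ ys) arcs =
    cong₂ _∷_ (trans (sym (arcs Fin.zero)) (cong (f ∘ head) tail≡)) tail≡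
    where tail≡ = arcs⇒≡pathTo n (y ∷ ys) (arcs ∘ Fin.suc)

module PathCount {V : Set} (f : V → V) (C : V → Set) (closed : ∀ v → C v → C (f v)) where

  open Paths f

  iter-closed : ∀ {j n} v → j ≤′ n → C (iter f j v) → C (iter f n v)
  iter-closed v (≤′-reflexive refl) c = c
  iter-closed v (≤′-step j≤′n)      c = closed _ (iter-closed v j≤′n c)

  hasLevel-suc : ∀ {n} v → C (iter f (suc n) v) → ¬ C (iter f n v) → HasLevel f C v (suc n)
  hasLevel-suc v c ¬c = c , λ { j (s≤s j≤n) → ¬c ∘ iter-closed v (≤⇒≤′ j≤n) }

  pathTo-isPath : ∀ n v → C (iter f n v) → IsPathFromC f C n (pathTo n v)
  pathTo-isPath n v c = subst C (sym (head-pathTo n v)) c , pathTo-arcs n v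

  isPath⇒pathTo : ∀ n p → IsPathFromC f C n p → Image (pathTo n) (λ v → C (iter f n v)) p
  isPath⇒pathTo n p (c , arcs) =
    v , subst C (trans (cong head p≡) (head-pathTo n v)) c , sym p≡
    where
    v  = lookup p (fromℕ n)
    p≡ = arcs⇒≡pathTo n p arcs

  extend-isPath : ∀ {n} {p : Vec V (suc n)} → IsPathFromC f C n p → IsPathFromC f C (suc n) (extend p)
  extend-isPath {p = p} (c , arcs) = closed _ c , extend-arcs p arcs

  pathCount-zero : ∀ {a c} → HasCount (λ v → HasLevel f C v 0) a → HasCount (IsPathFromC f C 0) c → a ≡ c
  pathCount-zero levels paths =
    HasCount-≡ (HasCount-Image (pathTo 0) (pathTo-injective 0) levels) paths
      (λ { _ (v , (c , _) , refl) → pathTo-isPath 0 v c })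
      (λ p isPath ¬image → let v , c , eq = isPath⇒pathTo 0 p isPath in ¬image (v , (c , λ _ ()) , eq))

  pathCount-suc : ∀ {n a b c} → HasCount (λ v → HasLevel f C v (suc n)) a →
                  HasCount (IsPathFromC f C n) b → HasCount (IsPathFromC f C (suc n)) c → a + b ≡ c
  pathCount-suc {n} levels paths paths′ =
    HasCount-≡ (HasCount-⊎ (HasCount-Image (pathTo (suc n)) (pathTo-injective (suc n)) levels)
                            (HasCount-Image extend extend-injective paths)
                            disjoint)
      paths′ ⊆paths′ paths′⊆¬¬
    where
    Levelled Extended : Vec V (suc (suc n)) → Set
    Levelled = Image (pathTo (suc n)) (λ v → HasLevel f C v (suc n))
    Extended = Image extend (IsPathFromC f C n)
    disjoint : ∀ w → Levelled w → ¬ Extended w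
    disjoint _ (v , (_ , below) , refl) (p , (c , _) , eq) =
      below n (n<1+n n) (subst C (trans (cong (head ∘ tail) eq) (head-pathTo n v)) c)
    ⊆paths′ : ∀ w → Levelled w ⊎ Extended w → IsPathFromC f C (suc n) w
    ⊆paths′ _ (inj₁ (v , (c , _) , refl)) = pathTo-isPath (suc n) v c
    ⊆paths′ _ (inj₂ (_ , isPath , refl))  = extend-isPath isPath
    paths′⊆¬¬ : ∀ w → IsPathFromC f C (suc n) w → ¬ ¬ (Levelled w ⊎ Extended w)
    paths′⊆¬¬ w isPath with isPath⇒pathTo (suc n) w isPath
    ... | v , c , refl = ¬¬-map split ¬¬-excluded-middle
      where
      split : Dec (C (iter f n v)) → Levelled (pathTo (suc n) v) ⊎ Extended (pathTo (suc n) v)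
      split (yes c′) = inj₂ (pathTo n v , pathTo-isPath n v c′ , refl)
      split (no ¬c′) = inj₁ (v , hasLevel-suc v c ¬c′ , refl)

+[m+n]-+n≡+m : ∀ m n → + (m + n) - + n ≡ + m
+[m+n]-+n≡+m m n = trans ([+m]-[+n]≡m⊖n (m + n) n) (trans (≤-⊖ (m≤n+m n m)) (cong +_ (m+n∸n≡m m n)))

lemma2p14 : (V : Set) (f : V → V) (C : V → Set)
    → IsLargestPermSubset f C
    → ((v : V) → ∃ λ k → C (iter f k v))
    → (hc gc : ℕ → ℕ)
    → ((n : ℕ) → HasCount (λ v → HasLevel f C v n) (hc n))
    → ((n : ℕ) → HasCount {Vec V (suc n)} (IsPathFromC f C n) (gc n))
    → (n : ℕ) → + hc n ≡ oneMinusX* (λ k → + gc k) n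
lemma2p14 V f C ((closed , _) , _) _ hc gc levels paths zero =
  cong +_ (PathCount.pathCount-zero f C closed (levels 0) (paths 0))
lemma2p14 V f C ((closed , _) , _) _ hc gc levels paths (suc n) = begin
  + hc (suc n)                   ≡⟨ sym (+[m+n]-+n≡+m (hc (suc n)) (gc n)) ⟩
  + (hc (suc n) + gc n) - + gc n ≡⟨ cong (λ m → + m - + gc n) hc[1+n]+gc[n]≡gc[1+n] ⟩
  + gc (suc n) - + gc n          ∎
  where
  hc[1+n]+gc[n]≡gc[1+n] : hc (suc n) + gc n ≡ gc (suc n)
  hc[1+n]+gc[n]≡gc[1+n] = PathCount.pathCount-suc f C closed (levels (suc n)) (paths n) (paths (suc n))
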